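{- Let $\mathcal M = (W,{\preccurlyeq},S,[\![\cdot]\!])$ be any dynamic poset model, $w\in W$ and $\varphi \in \mathcal L$. Then, the following are equivalent: (a) $\mathcal M, w \models \Box \varphi$; (b) $w \in \left ( \bigcap _{n<\omega} S^{ -n} [\![\varphi]\!] \right )^\circ$; (c) for all $n<\omega$, $\mathcal M, S^n (w) \models \varphi$.
   Context: The language $\mathcal L$ is built from propositional variables and $\bot$ using $\wedge,\vee,\to$ and the temporal modalities $\circ$ (next), $\Diamond$ (eventually), $\Box$ (henceforth). A dynamical topological system is $(X,\mathcal T,S)$ with $(X,\mathcal T)$ a topological space and $S\colon X\to X$ continuous; $A^\circ$ denotes the interior of $A$. A valuation assigns to every formula an open set $[\![\varphi]\!]$ such that $[\![\bot]\!]=\varnothing$, $[\![\varphi\wedge\psi]\!]=[\![\varphi]\!]\cap[\![\psi]\!]$, $[\![\varphi\vee\psi]\!]=[\![\varphi]\!]\cup[\![\psi]\!]$, $[\![\varphi\to\psi]\!]=((X\setminus[\![\varphi]\!])\cup[\![\psi]\!])^\circ$, $[\![\circ\varphi]\!]=S^{ -1}[\![\varphi]\!]$, $[\![\Diamond\varphi]\!]=\bigcup_{n\geq0}S^{ -n}[\![\varphi]\!]$, and $[\![\Box\varphi]\!]=\bigcup\{U\in\mathcal T: S[U]\subseteq U\subseteq[\![\varphi]\!]\}$. We write $\mathcal M,x\models\varphi$ iff $x\in[\![\varphi]\!]$. A dynamic poset model is such a model whose topology is the up-set topology of a partial order $\preccurlyeq$ on $W$ (a set is open iff it is upward closed, so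 $A^\circ=\{w:\ {\uparrow}w\subseteq A\}$); continuity of $S$ then means $S$ is monotone. -}

module Defs where

open import Level using (Level; Lift; lift) renaming (zero to lzero; suc to lsuc)
open import Data.Nat using (ℕ; zero; suc)
open import Data.Empty using (⊥)
open import Data.Product using (Σ; ∃; _×_; _,_)
open import Data.Sum using (_⊎_)
open import Relation.Binary.PropositionalEquality using (_≡_)
open import Relation.Binary.Structures using (IsPartialOrder)

data Form : Set where
  var  : ℕ → Form
  ⊥'   : Form
  _∧'_ : Form → Form → Form
  _∨'_ : Form → Form → Form
  _⇒'_ : Form → Form → Form
  ○'   : Form → Form
  ◇'   : Form → Form
  □'   : Form → Form

iter : {A : Set} → (A → A) → ℕ → A → A
iter f zero    x = x
iter f (suc n) x = f (iter f n x)

record DPModel : Set₁ where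
  field
    W         : Set
    _≼_       : W → W → Set
    isPO      : IsPartialOrder _≡_ _≼_
    S         : W → W
    S-mono    : ∀ {x y} → x ≼ y → S x ≼ S y
    V         : ℕ → W → Set
    V-up      : ∀ p {x y} → x ≼ y → V p x → V p y

module _ (M : DPModel) where
  open DPModel M

  -- open sets of the up-set topology = upward closed sets
  IsUp : ∀ {ℓ} → (W → Set ℓ) → Set ℓ
  IsUp A = ∀ {x y} → x ≼ y → A x → A y

  Int : ∀ {ℓ} → (W → Set ℓ) → W → Set ℓ
  Int A w = ∀ v → w ≼ v → A v

  -- ⟦φ⟧ as a predicate on W ;  M , w ⊨ φ  iff  ⟦ φ ⟧ w
  ⟦_⟧ : Form → W → Set₁
  ⟦ var p ⟧ w   = Lift (lsuc lzero) (V p w)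
  ⟦ ⊥' ⟧ w      = Lift (lsuc lzero) ⊥
  ⟦ φ ∧' ψ ⟧ w  = ⟦ φ ⟧ w × ⟦ ψ ⟧ w
  ⟦ φ ∨' ψ ⟧ w  = ⟦ φ ⟧ w ⊎ ⟦ ψ ⟧ w
  ⟦ φ ⇒' ψ ⟧ w  = Int (λ v → ⟦ φ ⟧ v → ⟦ ψ ⟧ v) w
  ⟦ ○' φ ⟧ w    = ⟦ φ ⟧ (S w)
  ⟦ ◇' φ ⟧ w    = ∃ λ n → ⟦ φ ⟧ (iter S n w)
  -- union of all open U with S[U] ⊆ U ⊆ ⟦φ⟧
  ⟦ □' φ ⟧ w    = Σ (W → Set) λ U →
                    IsUp U × (∀ x → U x → U (S x)) × (∀ x → U x → ⟦ φ ⟧ x) × U w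

-- Two general facts drive the proof.
--  * Persistence: every ⟦φ⟧ is an up-set, and so is the orbit set
--    ⋂ₙ S⁻ⁿ⟦φ⟧ because S (hence every Sⁿ) is monotone.  For an up-set A
--    the interior is A itself, which gives (b) ⇔ (c).
--  * Invariant up-sets versus orbits: an S-invariant set contained in ⟦φ⟧
--    contains the whole orbit of each of its points, which gives (a) ⇒ (c);
--    conversely the orbit cone {x : Sⁿ(w) ≼ x for some n} is an
--    S-invariant up-set containing w, and under (c) it lies inside ⟦φ⟧
--    by persistence, which gives (c) ⇒ (a).
module Submission where

open import Defs
open import Data.Nat using (ℕ; zero; suc)
open import Data.Product using (_×_; _,_; Σ)
open import Data.Sum using (inj₁; inj₂)
open import Level using (lift)
open import Function.Bundles using (_⇔_; mk⇔)
open import Function.Properties.Equivalence using () renaming (trans to ⇔-trans; sym to ⇔-sym)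
open import Relation.Binary.Structures using (IsPartialOrder; IsPreorder)

module _ (M : DPModel) where
  open DPModel M
  open IsPreorder (IsPartialOrder.isPreorder isPO)
    using () renaming (refl to ≼-refl; trans to ≼-trans)

  Invariant : (W → Set) → Set
  Invariant U = ∀ x → U x → U (S x)

  Orbit : ∀ {ℓ} → (W → Set ℓ) → W → Set ℓ
  Orbit P v = (n : ℕ) → P (iter S n v)

  iter-mono : ∀ n {x y} → x ≼ y → iter S n x ≼ iter S n y
  iter-mono zero    x≼y = x≼y
  iter-mono (suc n) x≼y = S-mono (iter-mono n x≼y)

  persist : ∀ φ → IsUp M (⟦_⟧ M φ)
  persist (var p)  x≼y (lift a)      = lift (V-up p x≼y a)
  persist ⊥'       x≼y (lift ())
  persist (φ ∧' ψ) x≼y (a , b)       = persist φ x≼y a , persist ψ x≼y b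
  persist (φ ∨' ψ) x≼y (inj₁ a)      = inj₁ (persist φ x≼y a)
  persist (φ ∨' ψ) x≼y (inj₂ b)      = inj₂ (persist ψ x≼y b)
  persist (φ ⇒' ψ) x≼y h             = λ v y≼v → h v (≼-trans x≼y y≼v)
  persist (○' φ)   x≼y a             = persist φ (S-mono x≼y) a
  persist (◇' φ)   x≼y (n , a)       = n , persist φ (iter-mono n x≼y) a
  persist (□' φ)   x≼y (U , up , inv , sub , u) = U , up , inv , sub , up x≼y u

  orbit-up : ∀ {ℓ} {P : W → Set ℓ} → IsUp M P → IsUp M (Orbit P)
  orbit-up P-up x≼y h n = P-up (iter-mono n x≼y) (h n)

  int-up : ∀ {ℓ} {A : W → Set ℓ} → IsUp M A → ∀ w → Int M A w ⇔ A w
  int-up A-up w = mk⇔ (λ h → h w ≼-refl) (λ a v w≼v → A-up w≼v a)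

  invariant-orbit : ∀ {U} → Invariant U → ∀ n {x} → U x → U (iter S n x)
  invariant-orbit inv zero    u = u
  invariant-orbit inv (suc n) u = inv _ (invariant-orbit inv n u)

  -- The orbit cone of w: the smallest invariant up-set containing w.
  Cone : W → W → Set
  Cone w x = Σ ℕ λ n → iter S n w ≼ x

  cone-up : ∀ w → IsUp M (Cone w)
  cone-up w x≼y (n , Sⁿw≼x) = n , ≼-trans Sⁿw≼x x≼y

  cone-invariant : ∀ w → Invariant (Cone w)
  cone-invariant w x (n , Sⁿw≼x) = suc n , S-mono Sⁿw≼x

  cone-sub : ∀ {ℓ} {P : W → Set ℓ} → IsUp M P → ∀ w → Orbit P w →
             ∀ x → Cone w x → P x
  cone-sub P-up w h x (n , Sⁿw≼x) = P-up Sⁿw≼x (h n)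

  box-orbit : ∀ φ w → ⟦_⟧ M (□' φ) w ⇔ Orbit (⟦_⟧ M φ) w
  box-orbit φ w = mk⇔ box⇒orbit orbit⇒box
    where
    box⇒orbit : ⟦_⟧ M (□' φ) w → Orbit (⟦_⟧ M φ) w
    box⇒orbit (U , _ , inv , sub , u) n = sub _ (invariant-orbit inv n u)

    orbit⇒box : Orbit (⟦_⟧ M φ) w → ⟦_⟧ M (□' φ) w
    orbit⇒box h = Cone w , cone-up w , cone-invariant w
                , cone-sub (persist φ) w h , (zero , ≼-refl)

lemma4p5 : (M : DPModel) (w : DPModel.W M) (φ : Form) →
    ((⟦_⟧ M (□' φ) w) ⇔ Int M (λ v → (n : ℕ) → ⟦_⟧ M φ (iter (DPModel.S M) n v)) w)
    × (Int M (λ v → (n : ℕ) → ⟦_⟧ M φ (iter (DPModel.S M) n v)) w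
    ⇔ ((n : ℕ) → ⟦_⟧ M φ (iter (DPModel.S M) n w)))
lemma4p5 M w φ = ⇔-trans a⇔c (⇔-sym b⇔c) , b⇔c
  where
  a⇔c : ⟦_⟧ M (□' φ) w ⇔ Orbit M (⟦_⟧ M φ) w
  a⇔c = box-orbit M φ w

  b⇔c : Int M (Orbit M (⟦_⟧ M φ)) w ⇔ Orbit M (⟦_⟧ M φ) w
  b⇔c = int-up M (orbit-up M (persist M φ)) w
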